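{- For every graph $G$: (1) $\widetilde{\omega}(G)=\omega(\widetilde{G})$; (2) $\mathrm{cideg}(G)=\mathrm{cideg}(\widetilde{G})$; (3) $\alpha(G)=\alpha(\widetilde{G})$ and $\alpha^{\mathrm{loc}}(G)=\alpha^{\mathrm{loc}}(\widetilde{G})$; (4) $\theta(G)=\theta(\widetilde{G})$ and $\theta^{\mathrm{loc}}(G)=\theta^{\mathrm{loc}}(\widetilde{G})$.
   Context: All graphs finite and simple. Two vertices are equivalent if they lie in exactly the same maximal cliques (true twins); the clique-quotient graph $\widetilde{G}$ has the equivalence classes as vertices, two distinct classes adjacent iff their vertices are adjacent in $G$. $\widetilde{\omega}(G)$ is the maximum, over maximal cliques $K$ of $G$, of the number of classes intersecting $K$. $\mathrm{cideg}(G)$ is the maximum over vertices of the number of maximal cliques containing it. $\omega$ is the clique number, $\alpha$ the independence number, $\theta$ the clique-cover number; for a parameter $\mu$, $\mu^{\mathrm{loc}}(G)=\max_v\mu(G[N[v]])$. -}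

module Defs where

open import Data.Nat using (ℕ; zero; suc; _⊔_; _⊓_)
open import Data.Bool using (Bool; true; false; not; _∧_; _∨_; _xor_; if_then_else_)
open import Data.Fin using (Fin; _<?_)
open import Data.Fin.Properties using () renaming (_≟_ to _≟ᶠ_)
open import Data.Fin.Subset using (Subset; ∣_∣)
open import Data.List using (List; []; _∷_; _++_; map; allFin; filterᵇ; foldr; length; concatMap)
open import Data.Bool.ListAction using (all; any)
open import Data.Vec using (Vec; lookup)
import Data.Vec as Vec
open import Data.Product using (_×_; Σ)
open import Relation.Nullary.Decidable using (⌊_⌋)
open import Relation.Binary.PropositionalEquality using (_≡_; _≢_)
open import Function.Bundles using (_⇔_)

record Graph (n : ℕ) : Set where
  field
    adj        : Fin n → Fin n → Bool
    adj-sym    : ∀ u v → adj u v ≡ adj v u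
    adj-irrefl : ∀ u → adj u u ≡ false
open Graph public

_∈ᵇ_ : ∀ {n} → Fin n → Subset n → Bool
u ∈ᵇ S = lookup S u

_==ᶠ_ : ∀ {n} → Fin n → Fin n → Bool
u ==ᶠ v = ⌊ u ≟ᶠ v ⌋

allSubsets : ∀ n → List (Subset n)
allSubsets zero    = Vec.[] ∷ []
allSubsets (suc n) = map (true Vec.∷_) (allSubsets n) ++ map (false Vec.∷_) (allSubsets n)

_⊆ᵇ_ : ∀ {n} → Subset n → Subset n → Bool
_⊆ᵇ_ {n} S T = all (λ u → not (u ∈ᵇ S) ∨ (u ∈ᵇ T)) (allFin n)

_==ˢ_ : ∀ {n} → Subset n → Subset n → Bool
S ==ˢ T = (S ⊆ᵇ T) ∧ (T ⊆ᵇ S)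

isClique : ∀ {n} → Graph n → Subset n → Bool
isClique {n} G S =
  all (λ u → all (λ v → not (u ∈ᵇ S ∧ v ∈ᵇ S ∧ not (u ==ᶠ v)) ∨ adj G u v) (allFin n)) (allFin n)

isIndependent : ∀ {n} → Graph n → Subset n → Bool
isIndependent {n} G S =
  all (λ u → all (λ v → not (u ∈ᵇ S ∧ v ∈ᵇ S ∧ adj G u v)) (allFin n)) (allFin n)

isMaximalClique : ∀ {n} → Graph n → Subset n → Bool
isMaximalClique {n} G S =
  isClique G S ∧ all (λ T → not (isClique G T ∧ (S ⊆ᵇ T)) ∨ (T ==ˢ S)) (allSubsets n)

maximalCliques : ∀ {n} → Graph n → List (Subset n)
maximalCliques {n} G = filterᵇ (isMaximalClique G) (allSubsets n)

twins : ∀ {n} → Graph n → Fin n → Fin n → Bool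
twins G u v = all (λ K → not ((u ∈ᵇ K) xor (v ∈ᵇ K))) (maximalCliques G)

maxList : List ℕ → ℕ
maxList = foldr _⊔_ 0

countᵇ : ∀ {A : Set} → (A → Bool) → List A → ℕ
countᵇ p xs = length (filterᵇ p xs)

closedNbhd : ∀ {n} → Graph n → Fin n → Subset n
closedNbhd G v = Vec.tabulate (λ u → (u ==ᶠ v) ∨ adj G v u)

-- number of equivalence classes meeting K: count the vertices u ∈ K that are
-- the least (in index) vertex of K in their equivalence class
classesMeeting : ∀ {n} → Graph n → Subset n → ℕ
classesMeeting {n} G K =
  countᵇ (λ u → u ∈ᵇ K ∧ not (any (λ v → v ∈ᵇ K ∧ ⌊ v <? u ⌋ ∧ twins G u v) (allFin n))) (allFin n)

omegaTilde : ∀ {n} → Graph n → ℕ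
omegaTilde G = maxList (map (classesMeeting G) (maximalCliques G))

omega : ∀ {n} → Graph n → ℕ
omega {n} G = maxList (map ∣_∣ (filterᵇ (isClique G) (allSubsets n)))

cideg : ∀ {n} → Graph n → ℕ
cideg {n} G = maxList (map (λ v → countᵇ (λ K → v ∈ᵇ K) (maximalCliques G)) (allFin n))

alphaOn : ∀ {n} → Graph n → Subset n → ℕ
alphaOn {n} G S = maxList (map ∣_∣ (filterᵇ (λ I → isIndependent G I ∧ (I ⊆ᵇ S)) (allSubsets n)))

alpha : ∀ {n} → Graph n → ℕ
alpha {n} G = alphaOn G (Vec.replicate n true)

alphaLoc : ∀ {n} → Graph n → ℕ
alphaLoc {n} G = maxList (map (λ v → alphaOn G (closedNbhd G v)) (allFin n))

listsOfLength : ∀ {A : Set} → List A → ℕ → List (List A)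
listsOfLength xs zero    = [] ∷ []
listsOfLength xs (suc k) = concatMap (λ x → map (x ∷_) (listsOfLength xs k)) xs

unionAll : ∀ {n} → List (Subset n) → Subset n
unionAll {n} = foldr (λ A B → Vec.zipWith _∨_ A B) (Vec.replicate n false)

-- G[S] can be covered by k cliques (cliques of G[S] = cliques of G inside S)
coverableBy : ∀ {n} → Graph n → Subset n → ℕ → Bool
coverableBy {n} G S k =
  any (λ Ks → all (λ K → isClique G K ∧ (K ⊆ᵇ S)) Ks ∧ (unionAll Ks ==ˢ S))
      (listsOfLength (allSubsets n) k)

-- least k ≤ bound (searching upward from `from`) with p k; fallback: bound
leastFrom : (ℕ → Bool) → ℕ → ℕ → ℕ
leastFrom p from zero      = from
leastFrom p from (suc fuel) = if p from then from else leastFrom p (suc from) fuel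

-- θ(G[S]): least number of cliques covering S (always ≤ n via singletons)
thetaOn : ∀ {n} → Graph n → Subset n → ℕ
thetaOn {n} G S = leastFrom (coverableBy G S) 0 n

theta : ∀ {n} → Graph n → ℕ
theta {n} G = thetaOn G (Vec.replicate n true)

thetaLoc : ∀ {n} → Graph n → ℕ
thetaLoc {n} G = maxList (map (λ v → thetaOn G (closedNbhd G v)) (allFin n))

-- H (on Fin m) is the clique-quotient graph of G via the class map q:
-- q is surjective, identifies exactly the equivalent vertices, and two
-- distinct classes are adjacent iff their vertices are adjacent in G.
record IsCliqueQuotient {n m : ℕ} (G : Graph n) (H : Graph m) (q : Fin n → Fin m) : Set where
  field
    surjective : ∀ (c : Fin m) → Σ (Fin n) (λ u → q u ≡ c)
    kernel     : ∀ (u v : Fin n) → (q u ≡ q v) ⇔ (twins G u v ≡ true)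
    adjacency  : ∀ (u v : Fin n) → q u ≢ q v → adj H (q u) (q v) ≡ adj G u v

-- Distinct twins are adjacent (a maximal clique through one of them contains the whole class) and
-- every maximal clique is a union of classes. Hence image under q and preimage along q are mutually
-- inverse bijections between the maximal cliques of G and of H, and a maximal clique K of G meets
-- exactly ∣ q[K] ∣ classes. An independent set meets each class at most once, so q maps it injectively
-- onto an independent set of H, while one chosen vertex per class maps independent sets back; clique
-- covers push forward and pull back in the same way. So α and θ of G restricted to the preimage of X
-- equal those of H restricted to X, and both V(G) and every closed neighbourhood N[v] are such preimages.

module Submission where

open import Defs
open import Data.Bool using (Bool; true; false; T; not; _∧_; _∨_; _xor_)
open import Data.Bool.ListAction using (all; any)
open import Data.Bool.Properties using (T-∧; T-∨; T-≡)
open import Data.Fin using (Fin; zero; suc; _<_; _<?_)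
open import Data.Fin.Induction using (<-wellFounded)
open import Data.Fin.Properties using (_≟_; <-cmp; any?; injective⇒≤)
open import Data.Fin.Subset using (Subset; _∈_; _⊆_; _∩_; ⊤; ∣_∣; inside; outside; ⁅_⁆)
open import Data.Fin.Subset.Properties
  using (⊆-refl; ⊆-trans; ⊆-antisym; drop-∷-⊆; p⊆q⇒∣p∣≤∣q∣; ∈⊤; x∈⁅x⁆; x∈⁅y⁆⇒x≡y; p∩q⊆p; p∩q⊆q
        ; x∈p∩q⁺)
open import Data.List using (List; []; _∷_; _++_; map; filterᵇ; length; allFin)
import Data.List as List
open import Data.List.Extrema.Nat using (argmax; argmax-all; f[xs]≤f[argmax])
open import Data.List.Membership.Propositional using (find; lose) renaming (_∈_ to _∈ˡ_)
open import Data.List.Membership.Propositional.Properties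
  using (∈-allFin; ∈-filter⁺; ∈-filter⁻; ∈-map⁺; ∈-map⁻; ∈-∃++; ∈-++⁻; ∈-++⁺ˡ; ∈-++⁺ʳ
        ; ∈-concatMap⁺; ∈-concatMap⁻)
open import Data.List.Properties using (length-map; length-++; length-tabulate)
open import Data.List.Relation.Binary.Subset.Propositional using () renaming (_⊆_ to _⊆ˡ_)
open import Data.List.Relation.Unary.All as All using (All)
open import Data.List.Relation.Unary.All.Properties using (all⁺; all⁻) renaming (map⁺ to All-map⁺)
open import Data.List.Relation.Unary.Any using (here; there)
open import Data.List.Relation.Unary.Any.Properties using (any⁺; any⁻)
open import Data.List.Relation.Unary.Unique.Propositional using (Unique; []; _∷_)
import Data.List.Relation.Unary.Unique.Propositional.Properties as Unique
open import Data.Nat using (ℕ; zero; suc; _+_; _≤_; z≤n; s≤s; s≤s⁻¹)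
open import Data.Nat.Properties
  using (≤-refl; ≤-trans; ≤-antisym; ≤-reflexive; ≤⇒≯; m≤n⇒m<n∨m≡n; +-suc; +-identityʳ
        ; m≤m⊔n; m≤n⊔m; ⊔-lub)
open import Data.Product using (_×_; _,_; ∃-syntax; proj₁; proj₂; uncurry)
open import Data.Sum using (_⊎_; inj₁; inj₂)
import Data.Sum as Sum
open import Data.Vec using (lookup; tabulate; here)
import Data.Vec as Vec
open import Data.Vec.Properties
  using ([]=⇒lookup; lookup⇒[]=; ∷-injectiveʳ; tabulate∘lookup; lookup∘tabulate
        ; lookup-zipWith; lookup-replicate)
open import Function using (_∘_; _⇔_; mk⇔; Equivalence)
open Equivalence using (to; from)
open import Induction.WellFounded using (Acc; acc)
open import Relation.Binary using (tri<; tri≈; tri>)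
open import Relation.Binary.PropositionalEquality
  using (_≡_; _≢_; refl; sym; trans; cong; subst; subst₂)
open Relation.Binary.PropositionalEquality.≡-Reasoning
open import Relation.Nullary using (¬_; contradiction; yes; no)
open import Relation.Nullary.Decidable using (T?; ⌊_⌋; toWitness; fromWitness; _×-dec_)

private variable
  A B : Set
  n m : ℕ

-- Maxima and lengths of lists

maxList-upper : ∀ {x xs} → x ∈ˡ xs → x ≤ maxList xs
maxList-upper {xs = y ∷ xs} (here refl) = m≤m⊔n y (maxList xs)
maxList-upper {xs = y ∷ xs} (there x∈) = ≤-trans (maxList-upper x∈) (m≤n⊔m y (maxList xs))

maxList-least : ∀ {k} xs → (∀ {x} → x ∈ˡ xs → x ≤ k) → maxList xs ≤ k
maxList-least []       _     = z≤n
maxList-least (x ∷ xs) bound = ⊔-lub (bound (here refl)) (maxList-least xs (bound ∘ there))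

maxList-map-mono : ∀ (f : A → ℕ) (g : B → ℕ) xs ys →
  (∀ {x} → x ∈ˡ xs → ∃[ y ] y ∈ˡ ys × f x ≤ g y) → maxList (map f xs) ≤ maxList (map g ys)
maxList-map-mono f g xs ys dominated = maxList-least (map f xs) bound
  where
  bound : ∀ {z} → z ∈ˡ map f xs → z ≤ maxList (map g ys)
  bound z∈ with ∈-map⁻ f z∈
  ... | x , x∈ , refl with dominated x∈
  ... | y , y∈ , fx≤gy = ≤-trans fx≤gy (maxList-upper (∈-map⁺ g y∈))

maxList-map-≡ : ∀ (f : A → ℕ) (g : B → ℕ) xs ys →
  (∀ {x} → x ∈ˡ xs → ∃[ y ] y ∈ˡ ys × f x ≤ g y) →
  (∀ {y} → y ∈ˡ ys → ∃[ x ] x ∈ˡ xs × g y ≤ f x) →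
  maxList (map f xs) ≡ maxList (map g ys)
maxList-map-≡ f g xs ys xs≤ys ys≤xs =
  ≤-antisym (maxList-map-mono f g xs ys xs≤ys) (maxList-map-mono g f ys xs ys≤xs)

maxList-allFin-surjective : ∀ (q : Fin n → Fin m) → (∀ c → ∃[ u ] q u ≡ c) →
  ∀ (f : Fin n → ℕ) (g : Fin m → ℕ) → (∀ u → f u ≡ g (q u)) →
  maxList (map f (allFin n)) ≡ maxList (map g (allFin m))
maxList-allFin-surjective q surjective f g f≡g∘q = maxList-map-≡ f g _ _
  (λ {u} _ → q u , ∈-allFin (q u) , ≤-reflexive (f≡g∘q u))
  (λ {c} _ → let u , qu≡c = surjective c in
    u , ∈-allFin u , ≤-reflexive (trans (cong g (sym qu≡c)) (sym (f≡g∘q u))))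

length-≤-⊆ : ∀ {xs ys : List A} → Unique xs → xs ⊆ˡ ys → length xs ≤ length ys
length-≤-⊆ {xs = []}     _             _     = z≤n
length-≤-⊆ {xs = x ∷ xs} (x∉xs ∷ uniq) xs⊆ys with ∈-∃++ (xs⊆ys (here refl))
... | ys₁ , ys₂ , refl = subst (suc (length xs) ≤_) (sym length-split)
      (s≤s (length-≤-⊆ uniq (λ y∈ → drop-x (xs⊆ys (there y∈)) (All.lookup x∉xs y∈))))
  where
  length-split : length (ys₁ ++ x ∷ ys₂) ≡ suc (length (ys₁ ++ ys₂))
  length-split = begin
    length (ys₁ ++ x ∷ ys₂)        ≡⟨ length-++ ys₁ ⟩
    length ys₁ + suc (length ys₂)  ≡⟨ +-suc (length ys₁) (length ys₂) ⟩
    suc (length ys₁ + length ys₂)  ≡⟨ cong suc (length-++ ys₁) ⟨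
    suc (length (ys₁ ++ ys₂))      ∎
  drop-x : ∀ {y} → y ∈ˡ ys₁ ++ x ∷ ys₂ → x ≢ y → y ∈ˡ ys₁ ++ ys₂
  drop-x y∈ x≢y with ∈-++⁻ ys₁ y∈
  ... | inj₁ y∈ys₁         = ∈-++⁺ˡ y∈ys₁
  ... | inj₂ (here refl)   = contradiction refl x≢y
  ... | inj₂ (there y∈ys₂) = ∈-++⁺ʳ ys₁ y∈ys₂

InjectiveOn : (A → B) → List A → Set
InjectiveOn f xs = ∀ {x y} → x ∈ˡ xs → y ∈ˡ xs → f x ≡ f y → x ≡ y

Unique-map⁺ : ∀ (f : A → B) {xs} → InjectiveOn f xs → Unique xs → Unique (map f xs)
Unique-map⁺ f {[]}     _   []            = []
Unique-map⁺ f {x ∷ xs} inj (x∉xs ∷ uniq) =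
  All-map⁺ (All.tabulate λ y∈ fx≡fy → All.lookup x∉xs y∈ (inj (here refl) (there y∈) fx≡fy))
  ∷ Unique-map⁺ f (λ x∈ y∈ → inj (there x∈) (there y∈)) uniq

length-≤-injectiveOn : ∀ (f : A → B) {xs ys} → Unique xs → InjectiveOn f xs →
  (∀ {x} → x ∈ˡ xs → f x ∈ˡ ys) → length xs ≤ length ys
length-≤-injectiveOn f {xs} uniq inj into = subst (_≤ _) (length-map f xs)
  (length-≤-⊆ (Unique-map⁺ f inj uniq) λ y∈ →
    let x , x∈ , y≡fx = ∈-map⁻ f y∈ in subst (_∈ˡ _) (sym y≡fx) (into x∈))

-- Boolean reflection

T-not : ∀ {b} → T (not b) ⇔ (¬ T b)
T-not {true}  = mk⇔ (λ ()) (λ ¬t → ¬t _)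
T-not {false} = mk⇔ (λ _ ()) _

T-implies : ∀ {a b} → T (not a ∨ b) ⇔ (T a → T b)
T-implies {true}  = mk⇔ (λ tb _ → tb) (λ f → f _)
T-implies {false} = mk⇔ (λ _ ()) _

T-not-xor : ∀ {a b} → T (not (a xor b)) → T a → T b
T-not-xor {true} {true} _ _ = _

T-all : ∀ (p : A → Bool) {xs} → (∀ x → x ∈ˡ xs) → T (all p xs) ⇔ (∀ x → T (p x))
T-all p {xs} complete = mk⇔
  (λ t x → All.lookup (all⁺ p xs t) (complete x))
  (λ f → all⁻ p {xs} (All.tabulate λ {x} _ → f x))

T-any : ∀ (p : A → Bool) xs → T (any p xs) ⇔ (∃[ x ] x ∈ˡ xs × T (p x))
T-any p xs = mk⇔ (find ∘ any⁻ p xs) (λ (x , x∈ , px) → any⁺ p (lose x∈ px))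

∈⇔T : ∀ {u : Fin n} {S} → u ∈ S ⇔ T (u ∈ᵇ S)
∈⇔T {u = u} {S} = mk⇔ (λ u∈S → from T-≡ ([]=⇒lookup u∈S)) (λ t → lookup⇒[]= u S (to T-≡ t))

∈-tabulate : ∀ (p : Fin n → Bool) {u} → u ∈ tabulate p ⇔ T (p u)
∈-tabulate p {u} = mk⇔
  (λ u∈ → subst T (lookup∘tabulate p u) (to ∈⇔T u∈))
  (λ t → from ∈⇔T (subst T (sym (lookup∘tabulate p u)) t))

T-==ᶠ : ∀ {u v : Fin n} → T (u ==ᶠ v) ⇔ u ≡ v
T-==ᶠ = mk⇔ toWitness fromWitness

⊆ᵇ⇔⊆ : ∀ {S S′ : Subset n} → T (S ⊆ᵇ S′) ⇔ S ⊆ S′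
⊆ᵇ⇔⊆ {S = S} {S′} = mk⇔
  (λ t {u} u∈S → from ∈⇔T (to T-implies (to (T-all member ∈-allFin) t u) (to ∈⇔T u∈S)))
  (λ S⊆S′ → from (T-all member ∈-allFin) λ u → from T-implies (to ∈⇔T ∘ S⊆S′ ∘ from ∈⇔T))
  where
  member : Fin _ → Bool
  member u = not (u ∈ᵇ S) ∨ (u ∈ᵇ S′)

==ˢ⇔≡ : ∀ {S S′ : Subset n} → T (S ==ˢ S′) ⇔ S ≡ S′
==ˢ⇔≡ {S = S} = mk⇔
  (λ t → let S⊆S′ , S′⊆S = to T-∧ t in ⊆-antisym (to ⊆ᵇ⇔⊆ S⊆S′) (to ⊆ᵇ⇔⊆ S′⊆S))
  (λ { refl → let S⊆ᵇS = from (⊆ᵇ⇔⊆ {S = S}) ⊆-refl in from T-∧ (S⊆ᵇS , S⊆ᵇS) })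

-- Finite subsets

∈-allSubsets : ∀ {n} (S : Subset n) → S ∈ˡ allSubsets n
∈-allSubsets {zero}  Vec.[]            = here refl
∈-allSubsets {suc n} (true Vec.∷ S)  = ∈-++⁺ˡ (∈-map⁺ (true Vec.∷_) (∈-allSubsets S))
∈-allSubsets {suc n} (false Vec.∷ S) = ∈-++⁺ʳ _ (∈-map⁺ (false Vec.∷_) (∈-allSubsets S))

allSubsets-unique : ∀ n → Unique (allSubsets n)
allSubsets-unique zero    = All.[] ∷ []
allSubsets-unique (suc n) = Unique.++⁺ (extend true) (extend false) heads-differ
  where
  extend : ∀ b → Unique (map (b Vec.∷_) (allSubsets n))
  extend b = Unique.map⁺ ∷-injectiveʳ (allSubsets-unique n)
  heads-differ : ∀ {S} → ¬ (S ∈ˡ map (true Vec.∷_) (allSubsets n) × S ∈ˡ map (false Vec.∷_) (allSubsets n))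
  heads-differ (S∈ , S∈′) with ∈-map⁻ _ S∈ | ∈-map⁻ _ S∈′
  ... | _ , _ , refl | _ , _ , ()

∈-filter-allSubsets : ∀ {n} {p : Subset n → Bool} {S} → S ∈ˡ filterᵇ p (allSubsets n) ⇔ T (p S)
∈-filter-allSubsets {n} {p} {S} =
  mk⇔ (proj₂ ∘ ∈-filter⁻ (T? ∘ p) {xs = allSubsets n}) (∈-filter⁺ (T? ∘ p) (∈-allSubsets S))

∈-listsOfLength : ∀ {xs : List A} {Ks} → (∀ {K} → K ∈ˡ Ks → K ∈ˡ xs) →
  Ks ∈ˡ listsOfLength xs (length Ks)
∈-listsOfLength {Ks = []}               _     = here refl
∈-listsOfLength {xs = xs} {Ks = K ∷ Ks} Ks⊆xs =
  ∈-concatMap⁺ (λ x → map (x ∷_) (listsOfLength xs (length Ks))) {xs}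
    (lose (Ks⊆xs (here refl)) (∈-map⁺ (K ∷_) (∈-listsOfLength (Ks⊆xs ∘ there))))

length-∈-listsOfLength : ∀ {xs : List A} k {Ks} → Ks ∈ˡ listsOfLength xs k → length Ks ≡ k
length-∈-listsOfLength zero    (here refl) = refl
length-∈-listsOfLength {xs = xs} (suc k) Ks∈
  with find (∈-concatMap⁻ (λ x → map (x ∷_) (listsOfLength xs k)) {xs} Ks∈)
... | _ , _ , Ks∈map with ∈-map⁻ _ Ks∈map
... | Ks′ , Ks′∈ , refl = cong suc (length-∈-listsOfLength k Ks′∈)

∈-unionAll : ∀ {Ks : List (Subset n)} {u} → u ∈ unionAll Ks ⇔ (∃[ K ] K ∈ˡ Ks × u ∈ K)
∈-unionAll {Ks = Ks} {u} = mk⇔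
  (λ u∈ → let K , K∈ , t = to (T-any (u ∈ᵇ_) Ks) (subst T (lookup-unionAll Ks) (to ∈⇔T u∈)) in
    K , K∈ , from ∈⇔T t)
  (λ (K , K∈ , u∈K) → from ∈⇔T (subst T (sym (lookup-unionAll Ks))
    (from (T-any (u ∈ᵇ_) Ks) (K , K∈ , to ∈⇔T u∈K))))
  where
  lookup-unionAll : ∀ Ks → u ∈ᵇ unionAll Ks ≡ any (u ∈ᵇ_) Ks
  lookup-unionAll []       = lookup-replicate u false
  lookup-unionAll (K ∷ Ks) =
    trans (lookup-zipWith _∨_ u K (unionAll Ks)) (cong (u ∈ᵇ K ∨_) (lookup-unionAll Ks))

countᵇ-tabulate : ∀ (p : B → Bool) (f : Fin n → B) → countᵇ p (List.tabulate f) ≡ ∣ tabulate (p ∘ f) ∣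
countᵇ-tabulate {n = zero}  p f = refl
countᵇ-tabulate {n = suc n} p f with p (f zero)
... | true  = cong suc (countᵇ-tabulate p (f ∘ suc))
... | false = countᵇ-tabulate p (f ∘ suc)

elements : Subset n → List (Fin n)
elements {n} S = filterᵇ (_∈ᵇ S) (allFin n)

length-elements : ∀ (S : Subset n) → length (elements S) ≡ ∣ S ∣
length-elements S = trans (countᵇ-tabulate (_∈ᵇ S) (λ u → u)) (cong ∣_∣ (tabulate∘lookup S))

∈-elements : ∀ (S : Subset n) {u} → u ∈ˡ elements S ⇔ u ∈ S
∈-elements {n} S {u} = mk⇔ (from ∈⇔T ∘ proj₂ ∘ ∈-filter⁻ (T? ∘ (_∈ᵇ S)) {xs = allFin n})
                             (∈-filter⁺ (T? ∘ (_∈ᵇ S)) (∈-allFin u) ∘ to ∈⇔T)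

∣∣-≤-injectiveOn : ∀ (f : Fin n → Fin m) {S S′} → (∀ {u} → u ∈ S → f u ∈ S′) →
  (∀ {u v} → u ∈ S → v ∈ S → f u ≡ f v → u ≡ v) → ∣ S ∣ ≤ ∣ S′ ∣
∣∣-≤-injectiveOn {n} f {S} {S′} into inj = subst₂ _≤_ (length-elements S) (length-elements S′)
  (length-≤-injectiveOn f (Unique.filter⁺ _ (Unique.allFin⁺ n))
    (λ u∈ v∈ → inj (to (∈-elements S) u∈) (to (∈-elements S) v∈))
    (from (∈-elements S′) ∘ into ∘ to (∈-elements S)))

⊆∧∣∣≤⇒≡ : ∀ {p q : Subset n} → p ⊆ q → ∣ q ∣ ≤ ∣ p ∣ → q ≡ p
⊆∧∣∣≤⇒≡ {p = Vec.[]}          {Vec.[]}          _   _ = refl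
⊆∧∣∣≤⇒≡ {p = inside Vec.∷ p}  {inside Vec.∷ q}  p⊆q ∣q∣≤∣p∣ =
  cong (inside Vec.∷_) (⊆∧∣∣≤⇒≡ (drop-∷-⊆ p⊆q) (s≤s⁻¹ ∣q∣≤∣p∣))
⊆∧∣∣≤⇒≡ {p = outside Vec.∷ p} {outside Vec.∷ q} p⊆q ∣q∣≤∣p∣ =
  cong (outside Vec.∷_) (⊆∧∣∣≤⇒≡ (drop-∷-⊆ p⊆q) ∣q∣≤∣p∣)
⊆∧∣∣≤⇒≡ {p = inside Vec.∷ p}  {outside Vec.∷ q} p⊆q _ with () ← p⊆q here
⊆∧∣∣≤⇒≡ {p = outside Vec.∷ p} {inside Vec.∷ q}  p⊆q ∣q∣≤∣p∣ =
  contradiction (s≤s (p⊆q⇒∣p∣≤∣q∣ (drop-∷-⊆ p⊆q))) (≤⇒≯ ∣q∣≤∣p∣)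

image : (Fin n → Fin m) → Subset n → Subset m
image {n} f S = tabulate λ c → any (λ u → u ∈ᵇ S ∧ (f u ==ᶠ c)) (allFin n)

preimage : (Fin n → Fin m) → Subset m → Subset n
preimage f X = tabulate λ u → f u ∈ᵇ X

module Along (f : Fin n → Fin m) where

  ∈-image⁺ : ∀ {S u} → u ∈ S → f u ∈ image f S
  ∈-image⁺ {S} {u} u∈S = from (∈-tabulate _)
    (from (T-any _ (allFin n)) (u , ∈-allFin u , from T-∧ (to ∈⇔T u∈S , from T-==ᶠ refl)))

  ∈-image⁻ : ∀ S {c} → c ∈ image f S → ∃[ u ] u ∈ S × f u ≡ c
  ∈-image⁻ S {c} c∈ with to (T-any _ (allFin n)) (to (∈-tabulate _) c∈)
  ... | u , _ , t = let u∈S , fu≡c = to (T-∧ {u ∈ᵇ S}) t in u , from ∈⇔T u∈S , to T-==ᶠ fu≡c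

  ∈-preimage : ∀ X {u} → u ∈ preimage f X ⇔ f u ∈ X
  ∈-preimage X = mk⇔ (from ∈⇔T ∘ to (∈-tabulate _)) (from (∈-tabulate _) ∘ to ∈⇔T)

  image-mono : ∀ {S S′} → S ⊆ S′ → image f S ⊆ image f S′
  image-mono {S} S⊆S′ c∈ with ∈-image⁻ S c∈
  ... | u , u∈S , refl = ∈-image⁺ (S⊆S′ u∈S)

  ⊆preimage⇒image⊆ : ∀ {S X} → S ⊆ preimage f X → image f S ⊆ X
  ⊆preimage⇒image⊆ {S} {X} S⊆ c∈ with ∈-image⁻ S c∈
  ... | u , u∈S , refl = to (∈-preimage X) (S⊆ u∈S)

  preimage-mono : ∀ {X X′} → X ⊆ X′ → preimage f X ⊆ preimage f X′
  preimage-mono {X} {X′} X⊆X′ = from (∈-preimage X′) ∘ X⊆X′ ∘ to (∈-preimage X)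

-- Cliques, independent sets and closed neighbourhoods

IsClique : Graph n → Subset n → Set
IsClique G S = ∀ {u v} → u ∈ S → v ∈ S → u ≢ v → T (adj G u v)

IsIndependent : Graph n → Subset n → Set
IsIndependent G S = ∀ {u v} → u ∈ S → v ∈ S → ¬ T (adj G u v)

IsMaximalClique : Graph n → Subset n → Set
IsMaximalClique G K = IsClique G K × (∀ {S} → IsClique G S → K ⊆ S → S ≡ K)

isClique⇔ : ∀ (G : Graph n) S → T (isClique G S) ⇔ IsClique G S
isClique⇔ {n} G S = mk⇔
  (λ t {u} {v} u∈S v∈S u≢v → to T-implies (entries t u v)
    (from T-∧ (to ∈⇔T u∈S , from T-∧ (to ∈⇔T v∈S , from T-not (u≢v ∘ to T-==ᶠ)))))
  (λ clique → from (T-all row ∈-allFin) λ u → from (T-all (entry u) ∈-allFin) λ v → from T-implies λ t →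
    let u∈S , rest = to T-∧ t ; v∈S , u≢v = to T-∧ rest
    in clique (from ∈⇔T u∈S) (from ∈⇔T v∈S) (to T-not u≢v ∘ from T-==ᶠ))
  where
  entry : Fin n → Fin n → Bool
  entry u v = not (u ∈ᵇ S ∧ v ∈ᵇ S ∧ not (u ==ᶠ v)) ∨ adj G u v
  row : Fin n → Bool
  row u = all (entry u) (allFin n)
  entries : T (isClique G S) → ∀ u v → T (entry u v)
  entries t u = to (T-all (entry u) ∈-allFin) (to (T-all row ∈-allFin) t u)

isIndependent⇔ : ∀ (G : Graph n) S → T (isIndependent G S) ⇔ IsIndependent G S
isIndependent⇔ {n} G S = mk⇔
  (λ t {u} {v} u∈S v∈S adjacent →
    to T-not (entries t u v) (from T-∧ (to ∈⇔T u∈S , from T-∧ (to ∈⇔T v∈S , adjacent))))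
  (λ independent → from (T-all row ∈-allFin) λ u → from (T-all (entry u) ∈-allFin) λ v → from T-not λ t →
    let u∈S , rest = to T-∧ t ; v∈S , adjacent = to T-∧ rest
    in independent (from ∈⇔T u∈S) (from ∈⇔T v∈S) adjacent)
  where
  entry : Fin n → Fin n → Bool
  entry u v = not (u ∈ᵇ S ∧ v ∈ᵇ S ∧ adj G u v)
  row : Fin n → Bool
  row u = all (entry u) (allFin n)
  entries : T (isIndependent G S) → ∀ u v → T (entry u v)
  entries t u = to (T-all (entry u) ∈-allFin) (to (T-all row ∈-allFin) t u)

isMaximalClique⇔ : ∀ (G : Graph n) K → T (isMaximalClique G K) ⇔ IsMaximalClique G K
isMaximalClique⇔ {n} G K = mk⇔ decode encode
  where
  noLarger : Subset n → Bool
  noLarger S = not (isClique G S ∧ (K ⊆ᵇ S)) ∨ (S ==ˢ K)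
  decode : T (isMaximalClique G K) → IsMaximalClique G K
  decode t = to (isClique⇔ G K) clique , λ {S} S-clique K⊆S →
    to ==ˢ⇔≡ (to T-implies (to (T-all noLarger ∈-allSubsets) maximal S)
                           (from T-∧ (from (isClique⇔ G S) S-clique , from ⊆ᵇ⇔⊆ K⊆S)))
    where
    clique : T (isClique G K)
    clique = proj₁ (to T-∧ t)
    maximal : T (all noLarger (allSubsets n))
    maximal = proj₂ (to T-∧ t)
  encode : IsMaximalClique G K → T (isMaximalClique G K)
  encode (clique , maximal) = from T-∧ (from (isClique⇔ G K) clique ,
    from (T-all noLarger ∈-allSubsets) λ S → from T-implies λ t →
      let S-clique , K⊆S = to (T-∧ {isClique G S}) t
      in from ==ˢ⇔≡ (maximal (to (isClique⇔ G S) S-clique) (to ⊆ᵇ⇔⊆ K⊆S)))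

∈-maximalCliques : ∀ (G : Graph n) {K} → K ∈ˡ maximalCliques G ⇔ IsMaximalClique G K
∈-maximalCliques G {K} =
  mk⇔ (to (isMaximalClique⇔ G K) ∘ to ∈-filter-allSubsets) (from ∈-filter-allSubsets ∘ from (isMaximalClique⇔ G K))

maximalCliquesContaining : Graph n → Fin n → List (Subset n)
maximalCliquesContaining G v = filterᵇ (v ∈ᵇ_) (maximalCliques G)

∈-maximalCliquesContaining : ∀ (G : Graph n) v {K} →
  K ∈ˡ maximalCliquesContaining G v ⇔ (IsMaximalClique G K × v ∈ K)
∈-maximalCliquesContaining {n} G v {K} = mk⇔
  (λ K∈ → let K∈maximal , v∈K = ∈-filter⁻ (T? ∘ (v ∈ᵇ_)) {xs = maximalCliques G} K∈ in
    to (∈-maximalCliques G) K∈maximal , from ∈⇔T v∈K)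
  (λ (K-maximal , v∈K) → ∈-filter⁺ (T? ∘ (v ∈ᵇ_)) (from (∈-maximalCliques G) K-maximal) (to ∈⇔T v∈K))

maximalCliquesContaining-unique : ∀ (G : Graph n) v → Unique (maximalCliquesContaining G v)
maximalCliquesContaining-unique {n} G v = Unique.filter⁺ _ (Unique.filter⁺ _ (allSubsets-unique n))

irreflexive : ∀ (G : Graph n) {u v} → u ≡ v → ¬ T (adj G u v)
irreflexive G {u} refl = subst T (adj-irrefl G u)

⁅⁆-clique : ∀ (G : Graph n) u → IsClique G ⁅ u ⁆
⁅⁆-clique G u v∈ w∈ v≢w = contradiction (trans (x∈⁅y⁆⇒x≡y u v∈) (sym (x∈⁅y⁆⇒x≡y u w∈))) v≢w

-- A largest clique containing C is maximal.
extendToMaximalClique : ∀ (G : Graph n) {C} → IsClique G C → ∃[ K ] IsMaximalClique G K × C ⊆ K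
extendToMaximalClique {n} G {C} C-clique =
  K , (proj₁ K-extends , maximal) , proj₂ K-extends
  where
  Extends : Subset n → Set
  Extends S = IsClique G S × C ⊆ S
  extends? : Subset n → Bool
  extends? S = isClique G S ∧ (C ⊆ᵇ S)
  candidates = filterᵇ extends? (allSubsets n)
  ∈-candidates : ∀ {S} → S ∈ˡ candidates ⇔ Extends S
  ∈-candidates {S} = mk⇔ decode encode
    where
    decode : S ∈ˡ candidates → Extends S
    decode S∈ = let clique , C⊆S = to T-∧ (to ∈-filter-allSubsets S∈) in
      to (isClique⇔ G S) clique , to ⊆ᵇ⇔⊆ C⊆S
    encode : Extends S → S ∈ˡ candidates
    encode (clique , C⊆S) = from ∈-filter-allSubsets (from T-∧ (from (isClique⇔ G S) clique , from ⊆ᵇ⇔⊆ C⊆S))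
  K = argmax ∣_∣ C candidates
  K-extends : Extends K
  K-extends = argmax-all ∣_∣ {P = Extends} (C-clique , ⊆-refl) (All.tabulate (to ∈-candidates))
  maximal : ∀ {S} → IsClique G S → K ⊆ S → S ≡ K
  maximal S-clique K⊆S = ⊆∧∣∣≤⇒≡ K⊆S
    (All.lookup (f[xs]≤f[argmax] C candidates) (from ∈-candidates (S-clique , λ x∈C → K⊆S (proj₂ K-extends x∈C))))

independentSetsIn : Graph n → Subset n → List (Subset n)
independentSetsIn {n} G S = filterᵇ (λ I → isIndependent G I ∧ (I ⊆ᵇ S)) (allSubsets n)

∈-independentSetsIn : ∀ (G : Graph n) S {I} → I ∈ˡ independentSetsIn G S ⇔ (IsIndependent G I × I ⊆ S)
∈-independentSetsIn G S {I} = mk⇔ decode encode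
  where
  decode : I ∈ˡ independentSetsIn G S → IsIndependent G I × I ⊆ S
  decode I∈ = let independent , I⊆S = to T-∧ (to ∈-filter-allSubsets I∈) in
    to (isIndependent⇔ G I) independent , to ⊆ᵇ⇔⊆ I⊆S
  encode : IsIndependent G I × I ⊆ S → I ∈ˡ independentSetsIn G S
  encode (independent , I⊆S) =
    from ∈-filter-allSubsets (from T-∧ (from (isIndependent⇔ G I) independent , from ⊆ᵇ⇔⊆ I⊆S))

alphaOn-≡ : ∀ (G : Graph n) (H : Graph m) S X →
  (∀ {I} → IsIndependent G I → I ⊆ S → ∃[ J ] (IsIndependent H J × J ⊆ X) × ∣ I ∣ ≤ ∣ J ∣) →
  (∀ {J} → IsIndependent H J → J ⊆ X → ∃[ I ] (IsIndependent G I × I ⊆ S) × ∣ J ∣ ≤ ∣ I ∣) →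
  alphaOn G S ≡ alphaOn H X
alphaOn-≡ G H S X G≤H H≤G = maxList-map-≡ ∣_∣ ∣_∣ (independentSetsIn G S) (independentSetsIn H X)
  (λ I∈ → let J , J-in , ∣I∣≤∣J∣ = uncurry G≤H (to (∈-independentSetsIn G S) I∈) in
    J , from (∈-independentSetsIn H X) J-in , ∣I∣≤∣J∣)
  (λ J∈ → let I , I-in , ∣J∣≤∣I∣ = uncurry H≤G (to (∈-independentSetsIn H X) J∈) in
    I , from (∈-independentSetsIn G S) I-in , ∣J∣≤∣I∣)

∈-closedNbhd : ∀ (G : Graph n) {u v} → u ∈ closedNbhd G v ⇔ (u ≡ v ⊎ T (adj G v u))
∈-closedNbhd G {u} {v} = mk⇔
  (Sum.map₁ (to T-==ᶠ) ∘ to (T-∨ {u ==ᶠ v}) ∘ to (∈-tabulate _))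
  (from (∈-tabulate _) ∘ from T-∨ ∘ Sum.map₁ (from T-==ᶠ))

-- Clique covers

IsCliqueCover : Graph n → Subset n → List (Subset n) → Set
IsCliqueCover G S Ks =
  (∀ {K} → K ∈ˡ Ks → IsClique G K × K ⊆ S) × (∀ {u} → u ∈ S → ∃[ K ] K ∈ˡ Ks × u ∈ K)

coverableBy⇔ : ∀ (G : Graph n) S k → T (coverableBy G S k) ⇔ (∃[ Ks ] length Ks ≡ k × IsCliqueCover G S Ks)
coverableBy⇔ {n} G S k = mk⇔ decode encode
  where
  cliqueIn : Subset n → Bool
  cliqueIn K = isClique G K ∧ (K ⊆ᵇ S)
  covers : List (Subset n) → Bool
  covers Ks = all cliqueIn Ks ∧ (unionAll Ks ==ˢ S)
  decode : T (coverableBy G S k) → ∃[ Ks ] length Ks ≡ k × IsCliqueCover G S Ks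
  decode t with to (T-any covers (listsOfLength (allSubsets n) k)) t
  ... | Ks , Ks∈ , Ks-covers = Ks , length-∈-listsOfLength k Ks∈ , cliques , cover
    where
    Ks-covers′ : T (all cliqueIn Ks) × T (unionAll Ks ==ˢ S)
    Ks-covers′ = to (T-∧ {all cliqueIn Ks}) Ks-covers
    cliques : ∀ {K} → K ∈ˡ Ks → IsClique G K × K ⊆ S
    cliques {K} K∈ =
      let clique , K⊆S = to (T-∧ {isClique G K}) (All.lookup (all⁺ cliqueIn Ks (proj₁ Ks-covers′)) K∈)
      in to (isClique⇔ G K) clique , to ⊆ᵇ⇔⊆ K⊆S
    cover : ∀ {u} → u ∈ S → ∃[ K ] K ∈ˡ Ks × u ∈ K
    cover u∈S = to ∈-unionAll (subst (_ ∈_) (sym (to ==ˢ⇔≡ (proj₂ Ks-covers′))) u∈S)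
  encode : ∃[ Ks ] length Ks ≡ k × IsCliqueCover G S Ks → T (coverableBy G S k)
  encode (Ks , refl , cliques , cover) = from (T-any covers (listsOfLength (allSubsets n) (length Ks)))
    ( Ks , ∈-listsOfLength (λ {K} _ → ∈-allSubsets K)
    , from T-∧ (all⁻ cliqueIn (All.tabulate cliqueIn-K) , from ==ˢ⇔≡ union≡S))
    where
    cliqueIn-K : ∀ {K} → K ∈ˡ Ks → T (cliqueIn K)
    cliqueIn-K {K} K∈ =
      from T-∧ (from (isClique⇔ G K) (proj₁ (cliques K∈)) , from ⊆ᵇ⇔⊆ (proj₂ (cliques K∈)))
    union≡S : unionAll Ks ≡ S
    union≡S = ⊆-antisym (λ u∈ → let _ , K∈ , u∈K = to ∈-unionAll u∈ in proj₂ (cliques K∈) u∈K)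
                        (from ∈-unionAll ∘ cover)

coverableBy-transfer : ∀ (G : Graph n) (H : Graph m) S X (F : Subset n → Subset m) →
  (∀ {K} → IsClique G K → K ⊆ S → IsClique H (F K) × F K ⊆ X) →
  (∀ {c} → c ∈ X → ∃[ u ] u ∈ S × ∀ {K} → u ∈ K → c ∈ F K) →
  ∀ k → T (coverableBy G S k) → T (coverableBy H X k)
coverableBy-transfer G H S X F cliques-map covered k t with to (coverableBy⇔ G S k) t
... | Ks , refl , cliques , cover =
  from (coverableBy⇔ H X k) (map F Ks , length-map F Ks , mapped-cliques , mapped-cover)
  where
  mapped-cliques : ∀ {K′} → K′ ∈ˡ map F Ks → IsClique H K′ × K′ ⊆ X
  mapped-cliques K′∈ with ∈-map⁻ F K′∈
  ... | K , K∈ , refl = uncurry cliques-map (cliques K∈)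
  mapped-cover : ∀ {c} → c ∈ X → ∃[ K′ ] K′ ∈ˡ map F Ks × c ∈ K′
  mapped-cover c∈X with covered c∈X
  ... | u , u∈S , c∈F with cover u∈S
  ... | K , K∈ , u∈K = F K , ∈-map⁺ F K∈ , c∈F u∈K

coverableBy-singletons : ∀ (G : Graph n) S → T (coverableBy G S n)
coverableBy-singletons {n} G S =
  from (coverableBy⇔ G S n) (map piece (allFin n) , length-pieces , cliques , cover)
  where
  piece : Fin n → Subset n
  piece u = S ∩ ⁅ u ⁆
  length-pieces : length (map piece (allFin n)) ≡ n
  length-pieces = trans (length-map piece (allFin n)) (length-tabulate (λ u → u))
  cliques : ∀ {K} → K ∈ˡ map piece (allFin n) → IsClique G K × K ⊆ S
  cliques K∈ with ∈-map⁻ piece K∈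
  ... | u , _ , refl =
    (λ v∈ w∈ → ⁅⁆-clique G u (p∩q⊆q S ⁅ u ⁆ v∈) (p∩q⊆q S ⁅ u ⁆ w∈)) , p∩q⊆p S ⁅ u ⁆
  cover : ∀ {u} → u ∈ S → ∃[ K ] K ∈ˡ map piece (allFin n) × u ∈ K
  cover {u} u∈S = piece u , ∈-map⁺ piece (∈-allFin u) , x∈p∩q⁺ (u∈S , x∈⁅x⁆ u)

leastFrom-cong : ∀ {p p′ : ℕ → Bool} → (∀ k → T (p k) ⇔ T (p′ k)) →
  ∀ a fuel → leastFrom p a fuel ≡ leastFrom p′ a fuel
leastFrom-cong         p⇔p′ a zero = refl
leastFrom-cong {p} {p′} p⇔p′ a (suc fuel) with p a in pa | p′ a in p′a
... | true  | true  = refl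
... | false | false = leastFrom-cong p⇔p′ (suc a) fuel
... | true  | false = contradiction (subst T p′a (to (p⇔p′ a) (subst T (sym pa) _))) λ ()
... | false | true  = contradiction (subst T pa (from (p⇔p′ a) (subst T (sym p′a) _))) λ ()

-- θ searches with fuel n on G but m on H; once a witness is within reach, the fuel is irrelevant.
leastFrom-fuel : ∀ (p : ℕ → Bool) {j} a fuel fuel′ → a ≤ j → j ≤ a + fuel → j ≤ a + fuel′ → T (p j) →
  leastFrom p a fuel ≡ leastFrom p a fuel′
leastFrom-fuel p a zero zero _ _ _ _ = refl
leastFrom-fuel p a zero (suc fuel′) a≤j j≤a _ pj with ≤-antisym (subst (_ ≤_) (+-identityʳ a) j≤a) a≤j
... | refl with p a
...   | true = refl
leastFrom-fuel p a (suc fuel) zero a≤j _ j≤a pj with ≤-antisym (subst (_ ≤_) (+-identityʳ a) j≤a) a≤j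
... | refl with p a
...   | true = refl
leastFrom-fuel p {j} a (suc fuel) (suc fuel′) a≤j j≤ j≤′ pj with p a in pa
... | true  = refl
... | false = leastFrom-fuel p (suc a) fuel fuel′ a<j
                (subst (j ≤_) (+-suc a fuel) j≤) (subst (j ≤_) (+-suc a fuel′) j≤′) pj
  where
  a<j : suc a ≤ j
  a<j with m≤n⇒m<n∨m≡n a≤j
  ... | inj₁ a<j  = a<j
  ... | inj₂ refl = contradiction (subst T pa pj) λ ()

-- Class representatives

isRepresentative : Graph n → Subset n → Fin n → Bool
isRepresentative {n} G K u = u ∈ᵇ K ∧ not (any (λ v → v ∈ᵇ K ∧ ⌊ v <? u ⌋ ∧ twins G u v) (allFin n))

representatives : Graph n → Subset n → Subset n
representatives G K = tabulate (isRepresentative G K)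

classesMeeting-representatives : ∀ (G : Graph n) K → classesMeeting G K ≡ ∣ representatives G K ∣
classesMeeting-representatives G K = countᵇ-tabulate (isRepresentative G K) (λ u → u)

∈-representatives : ∀ (G : Graph n) K {u} →
  u ∈ representatives G K ⇔ (u ∈ K × ∀ {v} → v ∈ K → v < u → ¬ T (twins G u v))
∈-representatives {n} G K {u} = mk⇔ decode encode
  where
  earlierTwin : Fin n → Bool
  earlierTwin v = v ∈ᵇ K ∧ ⌊ v <? u ⌋ ∧ twins G u v
  decode : u ∈ representatives G K → u ∈ K × ∀ {v} → v ∈ K → v < u → ¬ T (twins G u v)
  decode u∈ = let u∈K , none = to T-∧ (to (∈-tabulate _) u∈) in
    from ∈⇔T u∈K , λ {v} v∈K v<u twin → to T-not none
      (from (T-any earlierTwin (allFin n))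
        (v , ∈-allFin v , from T-∧ (to ∈⇔T v∈K , from T-∧ (fromWitness v<u , twin))))
  encode : u ∈ K × (∀ {v} → v ∈ K → v < u → ¬ T (twins G u v)) → u ∈ representatives G K
  encode (u∈K , none) = from (∈-tabulate _) (from T-∧ (to ∈⇔T u∈K , from T-not λ t →
    let v , _ , earlier = to (T-any earlierTwin (allFin n)) t
        v∈K , rest = to (T-∧ {v ∈ᵇ K}) earlier
        v<u , twin = to (T-∧ {⌊ v <? u ⌋}) rest
    in none (from ∈⇔T v∈K) (toWitness v<u) twin))

-- The clique quotient

module CliqueQuotient {G : Graph n} {H : Graph m} {q : Fin n → Fin m} (quotient : IsCliqueQuotient G H q) where

  open IsCliqueQuotient quotient
  open Along q

  section : Fin m → Fin n
  section c = proj₁ (surjective c)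

  q∘section : ∀ c → q (section c) ≡ c
  q∘section c = proj₂ (surjective c)

  section-injective : ∀ {c d} → section c ≡ section d → c ≡ d
  section-injective {c} {d} same = trans (sym (q∘section c)) (trans (cong q same) (q∘section d))

  adjacent⇔ : ∀ {u v} → q u ≢ q v → T (adj H (q u) (q v)) ⇔ T (adj G u v)
  adjacent⇔ {u} {v} different = mk⇔ (subst T (adjacency u v different)) (subst T (sym (adjacency u v different)))

  twins⇔sameClass : ∀ {u v} → T (twins G u v) ⇔ q u ≡ q v
  twins⇔sameClass {u} {v} = mk⇔ (from (kernel u v) ∘ to T-≡) (from T-≡ ∘ to (kernel u v))

  maximalClique-saturated : ∀ {K u v} → IsMaximalClique G K → q u ≡ q v → u ∈ K → v ∈ K
  maximalClique-saturated {K} {u} {v} K-maximal same u∈K =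
    from ∈⇔T (T-not-xor (All.lookup twins-all (from (∈-maximalCliques G) K-maximal)) (to ∈⇔T u∈K))
    where
    twins-all : All (T ∘ λ K → not ((u ∈ᵇ K) xor (v ∈ᵇ K))) (maximalCliques G)
    twins-all = all⁺ (λ K → not ((u ∈ᵇ K) xor (v ∈ᵇ K))) (maximalCliques G) (from twins⇔sameClass same)

  sameClass⇒adjacent : ∀ {u v} → q u ≡ q v → u ≢ v → T (adj G u v)
  sameClass⇒adjacent {u} same u≢v with extendToMaximalClique G (⁅⁆-clique G u)
  ... | K , K-maximal , ⁅u⁆⊆K = proj₁ K-maximal u∈K (maximalClique-saturated K-maximal same u∈K) u≢v
    where
    u∈K : u ∈ K
    u∈K = ⁅u⁆⊆K (x∈⁅x⁆ u)

  image∘preimage : ∀ X → image q (preimage q X) ≡ X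
  image∘preimage X = ⊆-antisym image⊆X X⊆image
    where
    image⊆X : image q (preimage q X) ⊆ X
    image⊆X c∈ with ∈-image⁻ (preimage q X) c∈
    ... | u , u∈ , refl = to (∈-preimage X) u∈
    X⊆image : X ⊆ image q (preimage q X)
    X⊆image {c} c∈X = subst (_∈ image q (preimage q X)) (q∘section c)
      (∈-image⁺ (from (∈-preimage X) (subst (_∈ X) (sym (q∘section c)) c∈X)))

  preimage∘image : ∀ {K} → IsMaximalClique G K → preimage q (image q K) ≡ K
  preimage∘image {K} K-maximal = ⊆-antisym saturated (from (∈-preimage (image q K)) ∘ ∈-image⁺)
    where
    saturated : preimage q (image q K) ⊆ K
    saturated u∈ with ∈-image⁻ K (to (∈-preimage (image q K)) u∈)
    ... | v , v∈K , same = maximalClique-saturated K-maximal same v∈K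

  preimage-clique : ∀ {X} → IsClique H X → IsClique G (preimage q X)
  preimage-clique {X} X-clique {u} {v} u∈ v∈ u≢v with q u ≟ q v
  ... | yes same     = sameClass⇒adjacent same u≢v
  ... | no different = to (adjacent⇔ different) (X-clique (to (∈-preimage X) u∈) (to (∈-preimage X) v∈) different)

  image-clique : ∀ {S} → IsClique G S → IsClique H (image q S)
  image-clique {S} S-clique c∈ d∈ c≢d with ∈-image⁻ S c∈ | ∈-image⁻ S d∈
  ... | u , u∈S , refl | v , v∈S , refl = from (adjacent⇔ c≢d) (S-clique u∈S v∈S (c≢d ∘ cong q))

  image-maximalClique : ∀ {K} → IsMaximalClique G K → IsMaximalClique H (image q K)
  image-maximalClique {K} K-maximal@(K-clique , K-largest) = image-clique K-clique , largest
    where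
    largest : ∀ {X} → IsClique H X → image q K ⊆ X → X ≡ image q K
    largest {X} X-clique image⊆X = begin
      X                        ≡⟨ image∘preimage X ⟨
      image q (preimage q X)   ≡⟨ cong (image q) (K-largest (preimage-clique X-clique) K⊆preimage) ⟩
      image q K                ∎
      where
      K⊆preimage : K ⊆ preimage q X
      K⊆preimage = subst (_⊆ _) (preimage∘image K-maximal) (preimage-mono image⊆X)

  preimage-maximalClique : ∀ {X} → IsMaximalClique H X → IsMaximalClique G (preimage q X)
  preimage-maximalClique {X} (X-clique , X-largest) = preimage-clique X-clique , largest
    where
    largest : ∀ {S} → IsClique G S → preimage q X ⊆ S → S ≡ preimage q X
    largest {S} S-clique preimage⊆S with extendToMaximalClique G S-clique
    ... | K , K-maximal , S⊆K = ⊆-antisym (subst (S ⊆_) K≡preimage S⊆K) preimage⊆S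
      where
      X⊆image : X ⊆ image q K
      X⊆image = subst (_⊆ _) (image∘preimage X) (image-mono (⊆-trans preimage⊆S S⊆K))
      K≡preimage : K ≡ preimage q X
      K≡preimage = begin
        K                        ≡⟨ preimage∘image K-maximal ⟨
        preimage q (image q K)   ≡⟨ cong (preimage q) (X-largest (image-clique (proj₁ K-maximal)) X⊆image) ⟩
        preimage q X             ∎

  maximalCliquesContaining-length : ∀ v →
    length (maximalCliquesContaining G v) ≡ length (maximalCliquesContaining H (q v))
  maximalCliquesContaining-length v = ≤-antisym
    (length-≤-injectiveOn (image q) (maximalCliquesContaining-unique G v) image-injective image-into)
    (length-≤-injectiveOn (preimage q) (maximalCliquesContaining-unique H (q v)) preimage-injective preimage-into)
    where
    image-into : ∀ {K} → K ∈ˡ maximalCliquesContaining G v → image q K ∈ˡ maximalCliquesContaining H (q v)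
    image-into K∈ = let K-maximal , v∈K = to (∈-maximalCliquesContaining G v) K∈ in
      from (∈-maximalCliquesContaining H (q v)) (image-maximalClique K-maximal , ∈-image⁺ v∈K)
    image-injective : InjectiveOn (image q) (maximalCliquesContaining G v)
    image-injective {K} {K′} K∈ K′∈ same = begin
      K                       ≡⟨ preimage∘image (proj₁ (to (∈-maximalCliquesContaining G v) K∈)) ⟨
      preimage q (image q K)  ≡⟨ cong (preimage q) same ⟩
      preimage q (image q K′) ≡⟨ preimage∘image (proj₁ (to (∈-maximalCliquesContaining G v) K′∈)) ⟩
      K′                      ∎
    preimage-into : ∀ {X} → X ∈ˡ maximalCliquesContaining H (q v) → preimage q X ∈ˡ maximalCliquesContaining G v
    preimage-into {X} X∈ = let X-maximal , qv∈X = to (∈-maximalCliquesContaining H (q v)) X∈ in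
      from (∈-maximalCliquesContaining G v) (preimage-maximalClique X-maximal , from (∈-preimage X) qv∈X)
    preimage-injective : InjectiveOn (preimage q) (maximalCliquesContaining H (q v))
    preimage-injective {X} {X′} _ _ same = begin
      X                         ≡⟨ image∘preimage X ⟨
      image q (preimage q X)    ≡⟨ cong (image q) same ⟩
      image q (preimage q X′)   ≡⟨ image∘preimage X′ ⟩
      X′                        ∎

  cideg-quotient : cideg G ≡ cideg H
  cideg-quotient = maxList-allFin-surjective q surjective _ _ maximalCliquesContaining-length

  leastInClass : ∀ c → ∃[ w ] q w ≡ c × (∀ {v} → v < w → q v ≢ c)
  leastInClass c = descend (section c) (q∘section c) (<-wellFounded (section c))
    where
    descend : ∀ u → q u ≡ c → Acc _<_ u → ∃[ w ] q w ≡ c × (∀ {v} → v < w → q v ≢ c)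
    descend u qu≡c (acc smaller) with any? (λ v → v <? u ×-dec q v ≟ c)
    ... | yes (v , v<u , qv≡c) = descend v qv≡c (smaller v<u)
    ... | no none              = u , qu≡c , λ v<u qv≡c → none (_ , v<u , qv≡c)

  classesMeeting-preimage : ∀ X → classesMeeting G (preimage q X) ≡ ∣ X ∣
  classesMeeting-preimage X = trans (classesMeeting-representatives G (preimage q X)) (≤-antisym
    (∣∣-≤-injectiveOn q (to (∈-preimage X) ∘ proj₁ ∘ to ∈-R) q-injective)
    (∣∣-≤-injectiveOn least least-into least-injective))
    where
    R = representatives G (preimage q X)
    ∈-R : ∀ {u} → u ∈ R ⇔ (u ∈ preimage q X × ∀ {v} → v ∈ preimage q X → v < u → ¬ T (twins G u v))
    ∈-R = ∈-representatives G (preimage q X)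
    q-injective : ∀ {u u′} → u ∈ R → u′ ∈ R → q u ≡ q u′ → u ≡ u′
    q-injective {u} {u′} u∈R u′∈R same with <-cmp u u′
    ... | tri< u<u′ _ _ = contradiction (from twins⇔sameClass (sym same))
                                        (proj₂ (to ∈-R u′∈R) (proj₁ (to ∈-R u∈R)) u<u′)
    ... | tri≈ _ u≡u′ _ = u≡u′
    ... | tri> _ _ u′<u = contradiction (from twins⇔sameClass same)
                                        (proj₂ (to ∈-R u∈R) (proj₁ (to ∈-R u′∈R)) u′<u)
    least : Fin m → Fin n
    least c = proj₁ (leastInClass c)
    q∘least : ∀ c → q (least c) ≡ c
    q∘least c = proj₁ (proj₂ (leastInClass c))
    least-into : ∀ {c} → c ∈ X → least c ∈ R
    least-into {c} c∈X = from ∈-R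
      ( from (∈-preimage X) (subst (_∈ X) (sym (q∘least c)) c∈X)
      , λ _ v<least twin →
          proj₂ (proj₂ (leastInClass c)) v<least (trans (sym (to twins⇔sameClass twin)) (q∘least c)))
    least-injective : ∀ {c d} → c ∈ X → d ∈ X → least c ≡ least d → c ≡ d
    least-injective {c} {d} _ _ same = trans (sym (q∘least c)) (trans (cong q same) (q∘least d))

  omegaTilde-quotient : omegaTilde G ≡ omega H
  omegaTilde-quotient = maxList-map-≡ (classesMeeting G) ∣_∣ (maximalCliques G) cliquesH imageOf maximalExtensionOf
    where
    cliquesH = filterᵇ (isClique H) (allSubsets m)
    imageOf : ∀ {K} → K ∈ˡ maximalCliques G → ∃[ X ] X ∈ˡ cliquesH × classesMeeting G K ≤ ∣ X ∣
    imageOf {K} K∈ =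
      image q K , from ∈-filter-allSubsets (from (isClique⇔ H (image q K)) (image-clique (proj₁ K-maximal))) ,
      ≤-reflexive (begin
        classesMeeting G K                        ≡⟨ cong (classesMeeting G) (preimage∘image K-maximal) ⟨
        classesMeeting G (preimage q (image q K)) ≡⟨ classesMeeting-preimage (image q K) ⟩
        ∣ image q K ∣                             ∎)
      where
      K-maximal : IsMaximalClique G K
      K-maximal = to (∈-maximalCliques G) K∈
    maximalExtensionOf : ∀ {X} → X ∈ˡ cliquesH → ∃[ K ] K ∈ˡ maximalCliques G × ∣ X ∣ ≤ classesMeeting G K
    maximalExtensionOf {X} X∈ with extendToMaximalClique H (to (isClique⇔ H X) (to ∈-filter-allSubsets X∈))
    ... | X′ , X′-maximal , X⊆X′ = preimage q X′ , from (∈-maximalCliques G) (preimage-maximalClique X′-maximal) ,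
      ≤-trans (p⊆q⇒∣p∣≤∣q∣ X⊆X′) (≤-reflexive (sym (classesMeeting-preimage X′)))

  alphaOn-preimage : ∀ X → alphaOn G (preimage q X) ≡ alphaOn H X
  alphaOn-preimage X = alphaOn-≡ G H (preimage q X) X pushforward pullback
    where
    pushforward : ∀ {I} → IsIndependent G I → I ⊆ preimage q X →
                  ∃[ J ] (IsIndependent H J × J ⊆ X) × ∣ I ∣ ≤ ∣ J ∣
    pushforward {I} I-independent I⊆ =
      image q I , (independent , ⊆preimage⇒image⊆ I⊆) , ∣∣-≤-injectiveOn q ∈-image⁺ q-injective
      where
      independent : IsIndependent H (image q I)
      independent c∈ d∈ with ∈-image⁻ I c∈ | ∈-image⁻ I d∈
      ... | u , u∈I , refl | v , v∈I , refl with q u ≟ q v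
      ... | yes same     = irreflexive H same
      ... | no different = I-independent u∈I v∈I ∘ to (adjacent⇔ different)
      q-injective : ∀ {u v} → u ∈ I → v ∈ I → q u ≡ q v → u ≡ v
      q-injective {u} {v} u∈I v∈I same with u ≟ v
      ... | yes u≡v = u≡v
      ... | no u≢v  = contradiction (sameClass⇒adjacent same u≢v) (I-independent u∈I v∈I)
    pullback : ∀ {J} → IsIndependent H J → J ⊆ X →
               ∃[ I ] (IsIndependent G I × I ⊆ preimage q X) × ∣ J ∣ ≤ ∣ I ∣
    pullback {J} J-independent J⊆X = image section J , (independent , image⊆preimage) ,
      ∣∣-≤-injectiveOn section {J} (Along.∈-image⁺ section) (λ _ _ → section-injective)
      where
      independent : IsIndependent G (image section J)
      independent u∈ v∈ with Along.∈-image⁻ section J u∈ | Along.∈-image⁻ section J v∈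
      ... | c , c∈J , refl | d , d∈J , refl with c ≟ d
      ... | yes same     = irreflexive G (cong section same)
      ... | no different = J-independent c∈J d∈J ∘ subst₂ (λ c d → T (adj H c d)) (q∘section c) (q∘section d)
                                                  ∘ from (adjacent⇔ classes-differ)
        where
        classes-differ : q (section c) ≢ q (section d)
        classes-differ same = different (subst₂ _≡_ (q∘section c) (q∘section d) same)
      image⊆preimage : image section J ⊆ preimage q X
      image⊆preimage u∈ with Along.∈-image⁻ section J u∈
      ... | c , c∈J , refl = from (∈-preimage X) (subst (_∈ X) (sym (q∘section c)) (J⊆X c∈J))

  coverableBy-preimage : ∀ X k → T (coverableBy G (preimage q X) k) ⇔ T (coverableBy H X k)
  coverableBy-preimage X k = mk⇔
    (coverableBy-transfer G H (preimage q X) X (image q)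
      (λ K-clique K⊆ → image-clique K-clique , ⊆preimage⇒image⊆ K⊆) pushed k)
    (coverableBy-transfer H G X (preimage q X) (preimage q)
      (λ X′-clique X′⊆X → preimage-clique X′-clique , preimage-mono X′⊆X) pulled k)
    where
    pushed : ∀ {c} → c ∈ X → ∃[ u ] u ∈ preimage q X × ∀ {K} → u ∈ K → c ∈ image q K
    pushed {c} c∈X = section c , from (∈-preimage X) (subst (_∈ X) (sym (q∘section c)) c∈X) ,
      λ {K} u∈K → subst (_∈ image q K) (q∘section c) (∈-image⁺ u∈K)
    pulled : ∀ {u} → u ∈ preimage q X → ∃[ c ] c ∈ X × ∀ {X′} → c ∈ X′ → u ∈ preimage q X′
    pulled {u} u∈ = q u , to (∈-preimage X) u∈ , λ {X′} → from (∈-preimage X′)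

  thetaOn-preimage : ∀ X → thetaOn G (preimage q X) ≡ thetaOn H X
  thetaOn-preimage X = begin
    leastFrom (coverableBy G (preimage q X)) 0 n  ≡⟨ leastFrom-cong (coverableBy-preimage X) 0 n ⟩
    leastFrom (coverableBy H X) 0 n               ≡⟨ leastFrom-fuel (coverableBy H X) 0 n m z≤n m≤n ≤-refl
                                                                    (coverableBy-singletons H X) ⟩
    leastFrom (coverableBy H X) 0 m               ∎
    where
    m≤n : m ≤ n
    m≤n = injective⇒≤ section-injective

  ⊤-preimage : ⊤ ≡ preimage q ⊤
  ⊤-preimage = ⊆-antisym (λ _ → from (∈-preimage ⊤) ∈⊤) (λ _ → ∈⊤)

  closedNbhd-preimage : ∀ v → closedNbhd G v ≡ preimage q (closedNbhd H (q v))
  closedNbhd-preimage v = ⊆-antisym (from (∈-preimage _) ∘ from (∈-closedNbhd H) ∘ pushed ∘ to (∈-closedNbhd G))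
                                    (from (∈-closedNbhd G) ∘ pulled ∘ to (∈-closedNbhd H) ∘ to (∈-preimage _))
    where
    pushed : ∀ {u} → u ≡ v ⊎ T (adj G v u) → q u ≡ q v ⊎ T (adj H (q v) (q u))
    pushed (inj₁ refl) = inj₁ refl
    pushed {u} (inj₂ adjacent) with q v ≟ q u
    ... | yes same     = inj₁ (sym same)
    ... | no different = inj₂ (from (adjacent⇔ different) adjacent)
    pulled : ∀ {u} → q u ≡ q v ⊎ T (adj H (q v) (q u)) → u ≡ v ⊎ T (adj G v u)
    pulled {u} (inj₁ same) with u ≟ v
    ... | yes u≡v = inj₁ u≡v
    ... | no u≢v  = inj₂ (sameClass⇒adjacent (sym same) (u≢v ∘ sym))
    pulled {u} (inj₂ adjacent) = inj₂ (to (adjacent⇔ λ same → irreflexive H same adjacent) adjacent)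

  global-and-local : ∀ (μG : Subset n → ℕ) (μH : Subset m → ℕ) → (∀ X → μG (preimage q X) ≡ μH X) →
    μG ⊤ ≡ μH ⊤ ×
    maxList (map (μG ∘ closedNbhd G) (allFin n)) ≡ maxList (map (μH ∘ closedNbhd H) (allFin m))
  global-and-local μG μH μ-preimage =
    trans (cong μG ⊤-preimage) (μ-preimage ⊤) ,
    maxList-allFin-surjective q surjective _ _ λ v → trans (cong μG (closedNbhd-preimage v)) (μ-preimage _)

corollary3p3 : ∀ {n m : ℕ} (G : Graph n) (H : Graph m) (q : Fin n → Fin m)
    → IsCliqueQuotient G H q
    → (omegaTilde G ≡ omega H)
      × (cideg G ≡ cideg H)
      × ((alpha G ≡ alpha H) × (alphaLoc G ≡ alphaLoc H))
      × ((theta G ≡ theta H) × (thetaLoc G ≡ thetaLoc H))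
corollary3p3 G H q quotient =
  omegaTilde-quotient ,
  cideg-quotient ,
  global-and-local (alphaOn G) (alphaOn H) alphaOn-preimage ,
  global-and-local (thetaOn G) (thetaOn H) thetaOn-preimage
  where
  open CliqueQuotient quotient
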